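{- Let $A_0=1$ and for $p>0$ let $A_p = (-1)^p + 2\sum_{j=0}^{\lfloor p/2\rfloor}\binom{p}{2j+1}A_{p-2j-1}$; let $B_0=1$ and for $p>0$ let $B_p = 2\sum_{j=0}^{\lfloor p/2\rfloor}\binom{p}{2j+1}B_{p-2j-1}$. For integers $p\ge 0$ and $n\ge 0$ let $\mathcal{S}_n^{(p)} = \sum_{i=0}^{n} i^p F_{i}$, where $i^0$ is interpreted as $1$ (also for $i=0$). Then for all integers $p\ge 0$ and $n \ge 0$, \[ \mathcal{S}_n^{(p)} \;=\; \left(\sum_{k=0}^{p}\binom{p}{k}(-1)^k A_k\, n^{p-k}\right)F_n \;+\; \left(\sum_{k=0}^{p}\binom{p}{k}(-1)^k B_k\, n^{p-k}\right)F_{n+1} \;-\; (-1)^p B_p. \]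
   Context: $F_n$ denotes the Fibonacci numbers: $F_0=0$, $F_1=1$, $F_n=F_{n-1}+F_{n-2}$ for $n>1$. Binomial coefficients $\binom{p}{m}$ with $m>p$ are $0$, so in the recursive definitions only terms with $2j+1\le p$ contribute. The convention $0^0=1$ is used throughout. -}

module Defs where

open import Data.Nat as ℕ using (ℕ; zero; suc; _∸_)
open import Data.Nat.Combinatorics using (_C_)
open import Data.Integer as ℤ using (ℤ; +_; -_; _+_; _*_; _-_)
open import Data.List using (List; []; _∷_)
open import Data.Bool using (Bool; true; false; if_then_else_; not)

fib : ℕ → ℕ
fib 0 = 0
fib 1 = 1
fib (suc (suc n)) = fib (suc n) ℕ.+ fib n

sgn : ℕ → ℤ
sgn zero = + 1
sgn (suc k) = - sgn k

-- natural powers in ℤ, with z ^ 0 = 1 (so 0^0 = 1)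
_^ᶻ_ : ℤ → ℕ → ℤ
z ^ᶻ zero = + 1
z ^ᶻ (suc k) = z * (z ^ᶻ k)

isOdd : ℕ → Bool
isOdd zero = false
isOdd (suc k) = not (isOdd k)

-- Given p and the list [X_{p-1}, X_{p-2}, ..., X_0] (position i holds X_{p-1-i}),
-- oddSum p xs = Σ_{j=0}^{⌊p/2⌋} C(p, 2j+1) X_{p-2j-1},
-- i.e. the sum over odd m = i+1 ≤ p of C(p,m) X_{p-m}  (terms with 2j+1 > p vanish).
oddSumFrom : ℕ → ℕ → List ℤ → ℤ
oddSumFrom p i [] = + 0
oddSumFrom p i (x ∷ xs) =
  (if isOdd (suc i) then + (p C suc i) * x else + 0) + oddSumFrom p (suc i) xs

oddSum : ℕ → List ℤ → ℤ
oddSum p xs = oddSumFrom p 0 xs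

-- Course-of-values tables: Atab p = [A_p, A_{p-1}, ..., A_0].
-- A_0 = 1,  A_p = (-1)^p + 2 Σ_j C(p,2j+1) A_{p-2j-1}  (p > 0)
Atab : ℕ → List ℤ
Atab zero = + 1 ∷ []
Atab (suc p) = (sgn (suc p) + + 2 * oddSum (suc p) (Atab p)) ∷ Atab p

Btab : ℕ → List ℤ
Btab zero = + 1 ∷ []
Btab (suc p) = (+ 2 * oddSum (suc p) (Btab p)) ∷ Btab p

headOr0 : List ℤ → ℤ
headOr0 [] = + 0
headOr0 (x ∷ _) = x

A : ℕ → ℤ
A p = headOr0 (Atab p)

B : ℕ → ℤ
B p = headOr0 (Btab p)

Σ≤ : ℕ → (ℕ → ℤ) → ℤ
Σ≤ zero f = f 0
Σ≤ (suc n) f = Σ≤ n f + f (suc n)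

S : ℕ → ℕ → ℤ
S p n = Σ≤ n (λ i → ((+ i) ^ᶻ p) * + fib i)

-- Read a sequence u as the exponential generating function Σ u_k x^k / k!.  Then the
-- binomial convolution ⋆ is the product of series, ones is e^x, powers n is e^{nx} and
-- odd is sinh x.  With Â_k = (-1)^k A_k and B̂_k = (-1)^k B_k, the recurrences defining
-- A and B say (1 + 2 sinh x) Â = e^x and (1 + 2 sinh x) B̂ = 1, so 1 + 2 sinh x is
-- invertible; together with e^{2x} = 1 + 2 e^x sinh x this gives B̂ e^x = Â and
-- Â e^x + Â = B̂ + e^x.  The polynomials in n of the theorem are the p-th coefficients
-- a_n, b_n of Â e^{nx} and B̂ e^{nx}, so b_{n+1} = a_n and a_{n+1} + a_n = b_n + (n+1)^p,
-- and the closed form follows by induction on n from F_{n+2} = F_{n+1} + F_n.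

{-# OPTIONS --safe #-}
module Submission where

open import Defs
open import Data.Nat using (ℕ; zero; suc; _∸_)
import Data.Nat as ℕ
import Data.Nat.Properties as ℕₚ
open import Data.Nat.Combinatorics using (_C_; nCk+nC[k+1]≡[n+1]C[k+1]; k>n⇒nCk≡0)
open import Data.Integer using (ℤ; +_; -_; _+_; _*_; _-_)
open import Data.Integer.Properties
open import Data.Integer.Tactic.RingSolver using (solve-∀)
open import Algebra.Properties.CommutativeSemigroup +-commutativeSemigroup
  using (interchange; x∙yz≈y∙xz)
open import Data.Bool using (true; false; if_then_else_)
open import Data.List using (List; []; _∷_)
open import Relation.Binary.PropositionalEquality
  using (_≡_; _≗_; refl; sym; trans; cong; cong₂; module ≡-Reasoning)
open ≡-Reasoning

Seq : Set
Seq = ℕ → ℤ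

infixl 6 _⊕_
infixr 7 _·_
infixl 7 _⋆_

shift : Seq → Seq
shift u k = u (suc k)

_⊕_ : Seq → Seq → Seq
(u ⊕ v) k = u k + v k

_·_ : ℤ → Seq → Seq
(c · u) k = c * u k

⊝_ : Seq → Seq
(⊝ u) k = - u k

zeros ones δ : Seq
zeros _ = + 0
ones _ = + 1
δ zero = + 1
δ (suc _) = + 0

-- The Leibniz rule (uv)' = u'v + uv'; binomialSum≡⋆ gives the closed form.
_⋆_ : Seq → Seq → Seq
(u ⋆ v) zero = u 0 * v 0
(u ⋆ v) (suc m) = (shift u ⋆ v) m + (u ⋆ shift v) m

⋆-cong : ∀ {u u′ v v′} → u ≗ u′ → v ≗ v′ → u ⋆ v ≗ u′ ⋆ v′
⋆-cong u≗u′ v≗v′ zero = cong₂ _*_ (u≗u′ 0) (v≗v′ 0)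
⋆-cong u≗u′ v≗v′ (suc m) =
  cong₂ _+_ (⋆-cong (λ k → u≗u′ (suc k)) v≗v′ m) (⋆-cong u≗u′ (λ k → v≗v′ (suc k)) m)

⋆-congˡ : ∀ {u u′} v → u ≗ u′ → u ⋆ v ≗ u′ ⋆ v
⋆-congˡ v u≗u′ = ⋆-cong u≗u′ (λ _ → refl)

⋆-congʳ : ∀ u {v v′} → v ≗ v′ → u ⋆ v ≗ u ⋆ v′
⋆-congʳ u = ⋆-cong (λ _ → refl)

⋆-comm : ∀ u v → u ⋆ v ≗ v ⋆ u
⋆-comm u v zero = *-comm (u 0) (v 0)
⋆-comm u v (suc m) = trans (cong₂ _+_ (⋆-comm (shift u) v m) (⋆-comm u (shift v) m))
                           (+-comm ((v ⋆ shift u) m) ((shift v ⋆ u) m))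

⋆-distribʳ-⊕ : ∀ u u′ v → (u ⊕ u′) ⋆ v ≗ u ⋆ v ⊕ u′ ⋆ v
⋆-distribʳ-⊕ u u′ v zero = *-distribʳ-+ (v 0) (u 0) (u′ 0)
⋆-distribʳ-⊕ u u′ v (suc m) = trans
  (cong₂ _+_ (⋆-distribʳ-⊕ (shift u) (shift u′) v m) (⋆-distribʳ-⊕ u u′ (shift v) m))
  (interchange ((shift u ⋆ v) m) ((shift u′ ⋆ v) m) ((u ⋆ shift v) m) ((u′ ⋆ shift v) m))

⋆-distribˡ-⊕ : ∀ u v v′ → u ⋆ (v ⊕ v′) ≗ u ⋆ v ⊕ u ⋆ v′
⋆-distribˡ-⊕ u v v′ m = begin
  (u ⋆ (v ⊕ v′)) m        ≡⟨ ⋆-comm u (v ⊕ v′) m ⟩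
  ((v ⊕ v′) ⋆ u) m        ≡⟨ ⋆-distribʳ-⊕ v v′ u m ⟩
  (v ⋆ u) m + (v′ ⋆ u) m  ≡⟨ cong₂ _+_ (⋆-comm v u m) (⋆-comm v′ u m) ⟩
  (u ⋆ v) m + (u ⋆ v′) m  ∎

⋆-scaleˡ : ∀ c u v → (c · u) ⋆ v ≗ c · (u ⋆ v)
⋆-scaleˡ c u v zero = *-assoc c (u 0) (v 0)
⋆-scaleˡ c u v (suc m) = trans
  (cong₂ _+_ (⋆-scaleˡ c (shift u) v m) (⋆-scaleˡ c u (shift v) m))
  (sym (*-distribˡ-+ c ((shift u ⋆ v) m) ((u ⋆ shift v) m)))

⋆-scaleʳ : ∀ c u v → u ⋆ (c · v) ≗ c · (u ⋆ v)
⋆-scaleʳ c u v m =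
  trans (⋆-comm u (c · v) m) (trans (⋆-scaleˡ c v u m) (cong (c *_) (⋆-comm v u m)))

⋆-negˡ : ∀ u v → (⊝ u) ⋆ v ≗ ⊝ (u ⋆ v)
⋆-negˡ u v zero = sym (neg-distribˡ-* (u 0) (v 0))
⋆-negˡ u v (suc m) = trans
  (cong₂ _+_ (⋆-negˡ (shift u) v m) (⋆-negˡ u (shift v) m))
  (sym (neg-distrib-+ ((shift u ⋆ v) m) ((u ⋆ shift v) m)))

⋆-negʳ : ∀ u v → u ⋆ (⊝ v) ≗ ⊝ (u ⋆ v)
⋆-negʳ u v m = trans (⋆-comm u (⊝ v) m) (trans (⋆-negˡ v u m) (cong -_ (⋆-comm v u m)))

⋆-assoc : ∀ u v w → (u ⋆ v) ⋆ w ≗ u ⋆ (v ⋆ w)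
⋆-assoc u v w zero = *-assoc (u 0) (v 0) (w 0)
⋆-assoc u v w (suc m) = begin
  ((shift u ⋆ v ⊕ u ⋆ shift v) ⋆ w) m + ((u ⋆ v) ⋆ shift w) m
    ≡⟨ cong (_+ ((u ⋆ v) ⋆ shift w) m) (⋆-distribʳ-⊕ (shift u ⋆ v) (u ⋆ shift v) w m) ⟩
  ((shift u ⋆ v) ⋆ w) m + ((u ⋆ shift v) ⋆ w) m + ((u ⋆ v) ⋆ shift w) m
    ≡⟨ cong₂ _+_ (cong₂ _+_ (⋆-assoc (shift u) v w m) (⋆-assoc u (shift v) w m))
                 (⋆-assoc u v (shift w) m) ⟩
  (shift u ⋆ (v ⋆ w)) m + (u ⋆ (shift v ⋆ w)) m + (u ⋆ (v ⋆ shift w)) m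
    ≡⟨ +-assoc ((shift u ⋆ (v ⋆ w)) m) ((u ⋆ (shift v ⋆ w)) m) ((u ⋆ (v ⋆ shift w)) m) ⟩
  (shift u ⋆ (v ⋆ w)) m + ((u ⋆ (shift v ⋆ w)) m + (u ⋆ (v ⋆ shift w)) m)
    ≡⟨ cong (λ x → (shift u ⋆ (v ⋆ w)) m + x) (⋆-distribˡ-⊕ u (shift v ⋆ w) (v ⋆ shift w) m) ⟨
  (shift u ⋆ (v ⋆ w)) m + (u ⋆ (shift v ⋆ w ⊕ v ⋆ shift w)) m
    ∎

⋆-zeroˡ : ∀ v → zeros ⋆ v ≗ zeros
⋆-zeroˡ v zero = *-zeroˡ (v 0)
⋆-zeroˡ v (suc m) = cong₂ _+_ (⋆-zeroˡ v m) (⋆-zeroˡ (shift v) m)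

⋆-identityˡ : ∀ v → δ ⋆ v ≗ v
⋆-identityˡ v zero = *-identityˡ (v 0)
⋆-identityˡ v (suc m) = trans (cong₂ _+_ (⋆-zeroˡ v m) (⋆-identityˡ (shift v) m)) (+-identityˡ _)

⋆-identityʳ : ∀ u → u ⋆ δ ≗ u
⋆-identityʳ u m = trans (⋆-comm u δ m) (⋆-identityˡ u m)

Σ≤-cong : ∀ n {f g : ℕ → ℤ} → (∀ k → k ℕ.≤ n → f k ≡ g k) → Σ≤ n f ≡ Σ≤ n g
Σ≤-cong zero f≗g = f≗g 0 ℕ.z≤n
Σ≤-cong (suc n) f≗g =
  cong₂ _+_ (Σ≤-cong n (λ k k≤n → f≗g k (ℕₚ.m≤n⇒m≤1+n k≤n))) (f≗g (suc n) ℕₚ.≤-refl)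

Σ≤-+ : ∀ n (f g : ℕ → ℤ) → Σ≤ n (λ k → f k + g k) ≡ Σ≤ n f + Σ≤ n g
Σ≤-+ zero f g = refl
Σ≤-+ (suc n) f g = trans (cong (_+ (f (suc n) + g (suc n))) (Σ≤-+ n f g))
                         (interchange (Σ≤ n f) (Σ≤ n g) (f (suc n)) (g (suc n)))

Σ≤-suc : ∀ n (f : ℕ → ℤ) → Σ≤ (suc n) f ≡ f 0 + Σ≤ n (λ k → f (suc k))
Σ≤-suc zero f = refl
Σ≤-suc (suc n) f = trans (cong (_+ f (suc (suc n))) (Σ≤-suc n f))
                         (+-assoc (f 0) (Σ≤ n (λ k → f (suc k))) (f (suc (suc n))))

binomialSum : Seq → Seq → Seq
binomialSum u v m = Σ≤ m (λ k → + (m C k) * u k * v (m ∸ k))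

pascal : ∀ m j x y → + (suc m C suc j) * x * y ≡ + (m C j) * x * y + + (m C suc j) * x * y
pascal m j x y = begin
  + (suc m C suc j) * x * y               ≡⟨ cong (λ c → + c * x * y) (nCk+nC[k+1]≡[n+1]C[k+1] m j) ⟨
  (+ (m C j) + + (m C suc j)) * x * y     ≡⟨ distrib (+ (m C j)) (+ (m C suc j)) x y ⟩
  + (m C j) * x * y + + (m C suc j) * x * y ∎
  where
  distrib : ∀ a b x y → (a + b) * x * y ≡ a * x * y + b * x * y
  distrib = solve-∀

binomialSum-suc : ∀ u v m →
  binomialSum u v (suc m) ≡ binomialSum (shift u) v m + binomialSum u (shift v) m
binomialSum-suc u v m = begin
  binomialSum u v (suc m)
    ≡⟨ Σ≤-suc m F ⟩
  F 0 + Σ≤ m (λ j → F (suc j))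
    ≡⟨ cong (λ x → F 0 + x) (Σ≤-cong m (λ j _ → pascal m j (u (suc j)) (v (m ∸ j)))) ⟩
  F 0 + Σ≤ m (λ j → G j + H j)
    ≡⟨ cong (λ x → F 0 + x) (Σ≤-+ m G H) ⟩
  F 0 + (binomialSum (shift u) v m + Σ≤ m H)
    ≡⟨ x∙yz≈y∙xz (F 0) (binomialSum (shift u) v m) (Σ≤ m H) ⟩
  binomialSum (shift u) v m + (F 0 + Σ≤ m H)
    ≡⟨ cong (λ x → binomialSum (shift u) v m + x) lower-terms ⟩
  binomialSum (shift u) v m + binomialSum u (shift v) m
    ∎
  where
  F G H K : ℕ → ℤ
  F k = + (suc m C k) * u k * v (suc m ∸ k)
  G j = + (m C j) * u (suc j) * v (m ∸ j)
  H j = + (m C suc j) * u (suc j) * v (m ∸ j)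
  K k = + (m C k) * u k * v (suc m ∸ k)

  top-term-vanishes : K (suc m) ≡ + 0
  top-term-vanishes = trans (cong (λ c → + c * u (suc m) * v (m ∸ m)) (k>n⇒nCk≡0 (ℕₚ.n<1+n m)))
                            (zero-product (u (suc m)) (v (m ∸ m)))
    where
    zero-product : ∀ x y → + 0 * x * y ≡ + 0
    zero-product = solve-∀

  lower-terms : F 0 + Σ≤ m H ≡ binomialSum u (shift v) m
  lower-terms = begin
    F 0 + Σ≤ m H
      ≡⟨ Σ≤-suc m K ⟨
    Σ≤ m K + K (suc m)
      ≡⟨ cong₂ _+_ (Σ≤-cong m (λ k k≤m → cong (λ i → + (m C k) * u k * v i) (ℕₚ.+-∸-assoc 1 k≤m)))
                   top-term-vanishes ⟩
    binomialSum u (shift v) m + + 0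
      ≡⟨ +-identityʳ _ ⟩
    binomialSum u (shift v) m
      ∎

binomialSum≡⋆ : ∀ u v → binomialSum u v ≗ u ⋆ v
binomialSum≡⋆ u v zero = cong (_* v 0) (*-identityˡ (u 0))
binomialSum≡⋆ u v (suc m) = trans (binomialSum-suc u v m)
  (cong₂ _+_ (binomialSum≡⋆ (shift u) v m) (binomialSum≡⋆ u (shift v) m))
signed : Seq → Seq
signed u k = sgn k * u k

sgn*sgn≡1 : ∀ k → sgn k * sgn k ≡ + 1
sgn*sgn≡1 zero = refl
sgn*sgn≡1 (suc k) = trans (neg*neg (sgn k)) (sgn*sgn≡1 k)
  where
  neg*neg : ∀ x → - x * - x ≡ x * x
  neg*neg = solve-∀

signed-δ : signed δ ≗ δ
signed-δ zero = refl
signed-δ (suc k) = *-zeroʳ (sgn (suc k))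

signed-⋆ : ∀ u v → signed (u ⋆ v) ≗ signed u ⋆ signed v
signed-⋆ u v zero = trans (*-identityˡ _) (sym (cong₂ _*_ (*-identityˡ (u 0)) (*-identityˡ (v 0))))
signed-⋆ u v (suc m) = begin
  - sgn m * ((shift u ⋆ v) m + (u ⋆ shift v) m)
    ≡⟨ distrib (sgn m) ((shift u ⋆ v) m) ((u ⋆ shift v) m) ⟩
  - signed (shift u ⋆ v) m + - signed (u ⋆ shift v) m
    ≡⟨ cong₂ (λ x y → - x + - y) (signed-⋆ (shift u) v m) (signed-⋆ u (shift v) m) ⟩
  - (signed (shift u) ⋆ signed v) m + - (signed u ⋆ signed (shift v)) m
    ≡⟨ cong₂ _+_ (⋆-negˡ (signed (shift u)) (signed v) m) (⋆-negʳ (signed u) (signed (shift v)) m) ⟨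
  (⊝ signed (shift u) ⋆ signed v) m + (signed u ⋆ ⊝ signed (shift v)) m
    ≡⟨ cong₂ _+_ (⋆-congˡ (signed v) (shift-signed u) m) (⋆-congʳ (signed u) (shift-signed v) m) ⟩
  (shift (signed u) ⋆ signed v) m + (signed u ⋆ shift (signed v)) m
    ∎
  where
  distrib : ∀ s x y → - s * (x + y) ≡ - (s * x) + - (s * y)
  distrib = solve-∀
  shift-signed : ∀ w → ⊝ signed (shift w) ≗ shift (signed w)
  shift-signed w k = neg-distribˡ-* (sgn k) (w (suc k))

odd : Seq
odd k = if isOdd k then + 1 else + 0

sgn-isOdd : ∀ k → sgn k ≡ (if isOdd k then - + 1 else + 1)
sgn-isOdd zero = refl
sgn-isOdd (suc k) with isOdd k | sgn-isOdd k
... | true  | sgn≡ = cong -_ sgn≡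
... | false | sgn≡ = cong -_ sgn≡

signed-odd : signed odd ≗ ⊝ odd
signed-odd k with isOdd k | sgn-isOdd k
... | true  | sgn≡ = trans (*-identityʳ (sgn k)) sgn≡
... | false | _    = *-zeroʳ (sgn k)

shift-odd⊕odd : shift odd ⊕ odd ≗ ones
shift-odd⊕odd k with isOdd k
... | true  = refl
... | false = refl

if-isOdd≡*odd : ∀ P m x → (if isOdd m then + (P C m) * x else + 0) ≡ + (P C m) * odd m * x
if-isOdd≡*odd P m x with isOdd m
... | true  = cong (_* x) (sym (*-identityʳ (+ (P C m))))
... | false = trans (sym (*-zeroˡ x)) (cong (_* x) (sym (*-zeroʳ (+ (P C m)))))

oddSumFrom-table : (tab : ℕ → List ℤ) (u : Seq) →
  tab 0 ≡ u 0 ∷ [] → (∀ q → tab (suc q) ≡ u (suc q) ∷ tab q) →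
  ∀ P i q → oddSumFrom P i (tab q) ≡
            Σ≤ q (λ j → + (P C suc (i ℕ.+ j)) * odd (suc (i ℕ.+ j)) * u (q ∸ j))
oddSumFrom-table tab u tab-zero tab-suc P i zero = begin
  oddSumFrom P i (tab 0)
    ≡⟨ cong (oddSumFrom P i) tab-zero ⟩
  (if isOdd (suc i) then + (P C suc i) * u 0 else + 0) + + 0
    ≡⟨ +-identityʳ _ ⟩
  (if isOdd (suc i) then + (P C suc i) * u 0 else + 0)
    ≡⟨ if-isOdd≡*odd P (suc i) (u 0) ⟩
  + (P C suc i) * odd (suc i) * u 0
    ≡⟨ cong (λ l → + (P C suc l) * odd (suc l) * u 0) (ℕₚ.+-identityʳ i) ⟨
  + (P C suc (i ℕ.+ 0)) * odd (suc (i ℕ.+ 0)) * u 0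
    ∎
oddSumFrom-table tab u tab-zero tab-suc P i (suc q) = begin
  oddSumFrom P i (tab (suc q))
    ≡⟨ cong (oddSumFrom P i) (tab-suc q) ⟩
  (if isOdd (suc i) then + (P C suc i) * u (suc q) else + 0) + oddSumFrom P (suc i) (tab q)
    ≡⟨ cong₂ _+_ (if-isOdd≡*odd P (suc i) (u (suc q))) (oddSumFrom-table tab u tab-zero tab-suc P (suc i) q) ⟩
  T i (suc q) + Σ≤ q (λ j → T (suc i ℕ.+ j) (q ∸ j))
    ≡⟨ cong₂ _+_ (cong (λ l → T l (suc q)) (ℕₚ.+-identityʳ i))
                 (Σ≤-cong q (λ j _ → cong (λ l → T l (q ∸ j)) (ℕₚ.+-suc i j))) ⟨
  T (i ℕ.+ 0) (suc q) + Σ≤ q (λ j → T (i ℕ.+ suc j) (q ∸ j))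
    ≡⟨ Σ≤-suc q (λ j → T (i ℕ.+ j) (suc q ∸ j)) ⟨
  Σ≤ (suc q) (λ j → T (i ℕ.+ j) (suc q ∸ j))
    ∎
  where
  T : ℕ → ℕ → ℤ
  T l r = + (P C suc l) * odd (suc l) * u r

oddSum-table : (tab : ℕ → List ℤ) (u : Seq) →
  tab 0 ≡ u 0 ∷ [] → (∀ q → tab (suc q) ≡ u (suc q) ∷ tab q) →
  ∀ p → oddSum (suc p) (tab p) ≡ (odd ⋆ u) (suc p)
oddSum-table tab u tab-zero tab-suc p = begin
  oddSum (suc p) (tab p)
    ≡⟨ oddSumFrom-table tab u tab-zero tab-suc (suc p) 0 p ⟩
  Σ≤ p (λ j → T (suc j))
    ≡⟨ +-identityˡ _ ⟨
  + 0 + Σ≤ p (λ j → T (suc j))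
    ≡⟨ cong (_+ Σ≤ p (λ j → T (suc j))) (*-zeroˡ (u (suc p))) ⟨
  T 0 + Σ≤ p (λ j → T (suc j))
    ≡⟨ Σ≤-suc p T ⟨
  binomialSum odd u (suc p)
    ≡⟨ binomialSum≡⋆ odd u (suc p) ⟩
  (odd ⋆ u) (suc p)
    ∎
  where
  T : ℕ → ℤ
  T k = + (suc p C k) * odd k * u (suc p ∸ k)

A-rec : A ≗ sgn ⊕ + 2 · (odd ⋆ A)
A-rec zero = refl
A-rec (suc p) = cong (λ x → sgn (suc p) + + 2 * x) (oddSum-table Atab A refl (λ _ → refl) p)

B-rec : B ≗ δ ⊕ + 2 · (odd ⋆ B)
B-rec zero = refl
B-rec (suc p) = trans (cong (+ 2 *_) (oddSum-table Btab B refl (λ _ → refl) p)) (sym (+-identityˡ _))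

G : Seq
G = δ ⊕ + 2 · odd

G⋆ : ∀ Z → G ⋆ Z ≗ Z ⊕ + 2 · (odd ⋆ Z)
G⋆ Z m = begin
  (G ⋆ Z) m                         ≡⟨ ⋆-distribʳ-⊕ δ (+ 2 · odd) Z m ⟩
  (δ ⋆ Z) m + ((+ 2 · odd) ⋆ Z) m   ≡⟨ cong₂ _+_ (⋆-identityˡ Z m) (⋆-scaleˡ (+ 2) odd Z m) ⟩
  Z m + + 2 * (odd ⋆ Z) m           ∎

G⋆-signed : ∀ X Y → X ≗ Y ⊕ + 2 · (odd ⋆ X) → G ⋆ signed X ≗ signed Y
G⋆-signed X Y X-rec k = begin
  (G ⋆ signed X) k                                 ≡⟨ G⋆ (signed X) k ⟩
  sgn k * X k + + 2 * d                            ≡⟨ cong (λ x → sgn k * x + + 2 * d) (X-rec k) ⟩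
  sgn k * (Y k + + 2 * c) + + 2 * d                ≡⟨ expand (sgn k) (Y k) c d ⟩
  sgn k * Y k + + 2 * (sgn k * c) + + 2 * d        ≡⟨ cong (λ x → sgn k * Y k + + 2 * x + + 2 * d) sgn*c≡-d ⟩
  sgn k * Y k + + 2 * - d + + 2 * d                ≡⟨ cancel (sgn k * Y k) d ⟩
  sgn k * Y k                                      ∎
  where
  c d : ℤ
  c = (odd ⋆ X) k
  d = (odd ⋆ signed X) k
  sgn*c≡-d : sgn k * c ≡ - d
  sgn*c≡-d = trans (signed-⋆ odd X k)
                   (trans (⋆-congˡ (signed X) signed-odd k) (⋆-negˡ odd (signed X) k))
  expand : ∀ s y c d → s * (y + + 2 * c) + + 2 * d ≡ s * y + + 2 * (s * c) + + 2 * d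
  expand = solve-∀
  cancel : ∀ y d → y + + 2 * - d + + 2 * d ≡ y
  cancel = solve-∀

Â B̂ : Seq
Â = signed A
B̂ = signed B

G⋆Â : G ⋆ Â ≗ ones
G⋆Â k = trans (G⋆-signed A sgn A-rec k) (sgn*sgn≡1 k)

G⋆B̂ : G ⋆ B̂ ≗ δ
G⋆B̂ k = trans (G⋆-signed B δ B-rec k) (signed-δ k)

B̂⋆G⋆-cancel : ∀ Z → B̂ ⋆ (G ⋆ Z) ≗ Z
B̂⋆G⋆-cancel Z m = begin
  (B̂ ⋆ (G ⋆ Z)) m   ≡⟨ ⋆-assoc B̂ G Z m ⟨
  ((B̂ ⋆ G) ⋆ Z) m   ≡⟨ ⋆-congˡ Z (λ k → trans (⋆-comm B̂ G k) (G⋆B̂ k)) m ⟩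
  (δ ⋆ Z) m         ≡⟨ ⋆-identityˡ Z m ⟩
  Z m               ∎

G⋆-injective : ∀ {Z W} → G ⋆ Z ≗ G ⋆ W → Z ≗ W
G⋆-injective {Z} {W} G⋆Z≗G⋆W m =
  trans (sym (B̂⋆G⋆-cancel Z m)) (trans (⋆-congʳ B̂ G⋆Z≗G⋆W m) (B̂⋆G⋆-cancel W m))

B̂⋆ones≗Â : B̂ ⋆ ones ≗ Â
B̂⋆ones≗Â = G⋆-injective λ m → begin
  (G ⋆ (B̂ ⋆ ones)) m   ≡⟨ ⋆-assoc G B̂ ones m ⟨
  ((G ⋆ B̂) ⋆ ones) m   ≡⟨ ⋆-congˡ ones G⋆B̂ m ⟩
  (δ ⋆ ones) m         ≡⟨ ⋆-identityˡ ones m ⟩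
  + 1                  ≡⟨ G⋆Â m ⟨
  (G ⋆ Â) m            ∎

ones⋆ones : ones ⋆ ones ≗ δ ⊕ + 2 · (odd ⋆ ones)
ones⋆ones zero = refl
ones⋆ones (suc m) = begin
  (ones ⋆ ones) m + (ones ⋆ ones) m   ≡⟨ double ((ones ⋆ ones) m) ⟩
  + 0 + + 2 * (ones ⋆ ones) m         ≡⟨ cong (λ x → + 0 + + 2 * x) odd⋆ones-suc ⟨
  + 0 + + 2 * (odd ⋆ ones) (suc m)    ∎
  where
  double : ∀ x → x + x ≡ + 0 + + 2 * x
  double = solve-∀
  odd⋆ones-suc : (odd ⋆ ones) (suc m) ≡ (ones ⋆ ones) m
  odd⋆ones-suc = trans (sym (⋆-distribʳ-⊕ (shift odd) odd ones m)) (⋆-congˡ ones shift-odd⊕odd m)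

Â⋆ones⊕Â≗B̂⊕ones : Â ⋆ ones ⊕ Â ≗ B̂ ⊕ ones
Â⋆ones⊕Â≗B̂⊕ones = G⋆-injective λ m → begin
  (G ⋆ (Â ⋆ ones ⊕ Â)) m
    ≡⟨ ⋆-distribˡ-⊕ G (Â ⋆ ones) Â m ⟩
  (G ⋆ (Â ⋆ ones)) m + (G ⋆ Â) m
    ≡⟨ cong₂ _+_ (trans (sym (⋆-assoc G Â ones m)) (⋆-congˡ ones G⋆Â m)) (G⋆Â m) ⟩
  (ones ⋆ ones) m + + 1
    ≡⟨ cong (_+ + 1) (ones⋆ones m) ⟩
  δ m + + 2 * (odd ⋆ ones) m + + 1
    ≡⟨ regroup (δ m) ((odd ⋆ ones) m) ⟩
  δ m + (+ 1 + + 2 * (odd ⋆ ones) m)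
    ≡⟨ cong₂ _+_ (G⋆B̂ m) (G⋆ ones m) ⟨
  (G ⋆ B̂) m + (G ⋆ ones) m
    ≡⟨ ⋆-distribˡ-⊕ G B̂ ones m ⟨
  (G ⋆ (B̂ ⊕ ones)) m
    ∎
  where
  regroup : ∀ d c → d + + 2 * c + + 1 ≡ d + (+ 1 + + 2 * c)
  regroup = solve-∀

powers : ℕ → Seq
powers n j = (+ n) ^ᶻ j

powers-zero : powers 0 ≗ δ
powers-zero zero = refl
powers-zero (suc j) = *-zeroˡ (powers 0 j)

powers-suc : ∀ n → powers (suc n) ≗ ones ⋆ powers n
powers-suc n zero = refl
powers-suc n (suc j) = begin
  (+ 1 + + n) * powers (suc n) j               ≡⟨ distrib (+ n) (powers (suc n) j) ⟩
  powers (suc n) j + + n * powers (suc n) j    ≡⟨ cong (λ x → x + + n * x) (powers-suc n j) ⟩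
  (ones ⋆ powers n) j + + n * (ones ⋆ powers n) j
    ≡⟨ cong (λ x → (ones ⋆ powers n) j + x) (⋆-scaleʳ (+ n) ones (powers n) j) ⟨
  (ones ⋆ powers n) j + (ones ⋆ (+ n · powers n)) j ∎
  where
  distrib : ∀ a x → (+ 1 + a) * x ≡ x + a * x
  distrib = solve-∀

⋆-powers-suc : ∀ u n → u ⋆ powers (suc n) ≗ (u ⋆ ones) ⋆ powers n
⋆-powers-suc u n p = trans (⋆-congʳ u (powers-suc n) p) (sym (⋆-assoc u ones (powers n) p))

B̂⋆powers-suc : ∀ n → B̂ ⋆ powers (suc n) ≗ Â ⋆ powers n
B̂⋆powers-suc n p = trans (⋆-powers-suc B̂ n p) (⋆-congˡ (powers n) B̂⋆ones≗Â p)

Â⋆powers-suc : ∀ n → Â ⋆ powers (suc n) ⊕ Â ⋆ powers n ≗ B̂ ⋆ powers n ⊕ powers (suc n)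
Â⋆powers-suc n p = begin
  (Â ⋆ powers (suc n)) p + (Â ⋆ powers n) p
    ≡⟨ cong (_+ (Â ⋆ powers n) p) (⋆-powers-suc Â n p) ⟩
  ((Â ⋆ ones) ⋆ powers n) p + (Â ⋆ powers n) p
    ≡⟨ ⋆-distribʳ-⊕ (Â ⋆ ones) Â (powers n) p ⟨
  ((Â ⋆ ones ⊕ Â) ⋆ powers n) p
    ≡⟨ ⋆-congˡ (powers n) Â⋆ones⊕Â≗B̂⊕ones p ⟩
  ((B̂ ⊕ ones) ⋆ powers n) p
    ≡⟨ ⋆-distribʳ-⊕ B̂ ones (powers n) p ⟩
  (B̂ ⋆ powers n) p + (ones ⋆ powers n) p
    ≡⟨ cong (λ x → (B̂ ⋆ powers n) p + x) (powers-suc n p) ⟨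
  (B̂ ⋆ powers n) p + powers (suc n) p
    ∎

S-closed-form : ∀ p n →
  S p n ≡ (Â ⋆ powers n) p * + fib n + (B̂ ⋆ powers n) p * + fib (suc n) - sgn p * B p
S-closed-form p zero = begin
  powers 0 p * + 0                   ≡⟨ *-zeroʳ (powers 0 p) ⟩
  + 0                                ≡⟨ vanish a (B̂ p) ⟨
  a * + 0 + B̂ p * + 1 - B̂ p          ≡⟨ cong (λ b → a * + 0 + b * + 1 - B̂ p) b₀≡B̂ ⟨
  a * + 0 + b₀ * + 1 - B̂ p           ∎
  where
  a b₀ : ℤ
  a = (Â ⋆ powers 0) p
  b₀ = (B̂ ⋆ powers 0) p
  b₀≡B̂ : b₀ ≡ B̂ p
  b₀≡B̂ = trans (⋆-congʳ B̂ powers-zero p) (⋆-identityʳ B̂ p)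
  vanish : ∀ a y → a * + 0 + y * + 1 - y ≡ + 0
  vanish = solve-∀
S-closed-form p (suc n) = begin
  S p n + P * F₁
    ≡⟨ cong (_+ P * F₁) (S-closed-form p n) ⟩
  a * F₀ + b * F₁ - s + P * F₁
    ≡⟨ regroup a b P F₀ F₁ s ⟩
  (b + P - a) * F₁ + a * (F₁ + F₀) - s
    ≡⟨ cong₂ (λ x y → x * F₁ + y * (F₁ + F₀) - s) a′≡b+P-a (B̂⋆powers-suc n p) ⟨
  (Â ⋆ powers (suc n)) p * F₁ + (B̂ ⋆ powers (suc n)) p * (F₁ + F₀) - s
    ∎
  where
  a b a′ P F₀ F₁ s : ℤ
  a = (Â ⋆ powers n) p
  b = (B̂ ⋆ powers n) p
  a′ = (Â ⋆ powers (suc n)) p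
  P = powers (suc n) p
  F₀ = + fib n
  F₁ = + fib (suc n)
  s = sgn p * B p
  a′≡b+P-a : a′ ≡ b + P - a
  a′≡b+P-a = trans (sym (x+y-y≡x a′ a)) (cong (_- a) (Â⋆powers-suc n p))
    where
    x+y-y≡x : ∀ x y → x + y - y ≡ x
    x+y-y≡x = solve-∀
  regroup : ∀ a b P F₀ F₁ s → a * F₀ + b * F₁ - s + P * F₁ ≡ (b + P - a) * F₁ + a * (F₁ + F₀) - s
  regroup = solve-∀

Σ≤-signed-binomial : ∀ X p n →
  Σ≤ p (λ k → + (p C k) * sgn k * X k * ((+ n) ^ᶻ (p ∸ k))) ≡ (signed X ⋆ powers n) p
Σ≤-signed-binomial X p n = trans
  (Σ≤-cong p (λ k _ → cong (_* powers n (p ∸ k)) (*-assoc (+ (p C k)) (sgn k) (X k))))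
  (binomialSum≡⋆ (signed X) (powers n) p)

theorem3 : (p n : ℕ) →
    S p n ≡
      (Σ≤ p (λ k → + (p C k) * sgn k * A k * ((+ n) ^ᶻ (p ∸ k)))) * + fib n
      + (Σ≤ p (λ k → + (p C k) * sgn k * B k * ((+ n) ^ᶻ (p ∸ k)))) * + fib (suc n)
      - sgn p * B p
theorem3 p n rewrite Σ≤-signed-binomial A p n | Σ≤-signed-binomial B p n = S-closed-form p n
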